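{- For $n\ge 1$, $$CGPSV(n)=\begin{cases}0&\text{if } n=1,\\2&\text{if } n=2,\\1&\text{otherwise,}\end{cases}\qquad CGPSV(n,t)=\begin{cases}1&\text{if } t=1,\ n=2,\\1&\text{if } t=2,\ n\ge 2,\\0&\text{otherwise.}\end{cases}$$
   Context: A simple game is a pair $(N,W)$ with $N=\{1,\dots,n\}$ and $W$ a family of subsets of $N$ (the winning coalitions) such that $N\in W$, $\emptyset\notin W$, and $S\in W$, $S\subseteq T\subseteq N$ imply $T\in W$. Players $i,j$ are equally desirable ($i\approx j$) if $S\cup\{i\}\in W\iff S\cup\{j\}\in W$ for all $S\subseteq N\setminus\{i,j\}$; $i\succsim j$ if $S\cup\{j\}\in W\Rightarrow S\cup\{i\}\in W$ for all $S\subseteq N\setminus\{i,j\}$. The game is complete if $\succsim$ is a complete preorder. The number of types $t$ is the number of equivalence classes of $\approx$. Player $i$ is a passer if $\{i\}\in W$; player $i$ has semi-veto if $N\setminus\{i\}\in W$ and $i\in S$ for every $S\in W$ other than $N\setminus\{i\}$. $CGPSV(n)$ is the number of isomorphism classes (isomorphism = bijection of players preserving winning coalitions) of complete simple games with $n$ players containing at least one passer and at least one semi-vetoer (both roles may be taken by the same player); $CGPSV(n,t)$ is the number of those with exactly $t$ types. -}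

module Defs where

open import Data.Nat using (ℕ; zero; suc)
open import Data.Bool using (Bool; true; false)
open import Data.Fin using (Fin)
open import Data.Fin.Subset using (Subset; ⊤; ⊥; ⁅_⁆; _∈_; _∉_; _⊆_; _∪_; _-_)
open import Data.Fin.Permutation using (Permutation′; _⟨$⟩ˡ_)
open import Data.Vec using (Vec; lookup; tabulate)
open import Data.Vec.Relation.Unary.All using (All)
open import Data.Product using (Σ; ∃; _×_; _,_)
open import Data.Sum using (_⊎_)
open import Relation.Binary.PropositionalEquality using (_≡_; _≢_)
open import Relation.Nullary using (¬_)

Family : ℕ → Set
Family n = Subset n → Bool

Win : ∀ {n} → Family n → Subset n → Set
Win W S = W S ≡ true

IsSimpleGame : ∀ {n} → Family n → Set
IsSimpleGame W = Win W ⊤ × ¬ Win W ⊥ × (∀ S T → Win W S → S ⊆ T → Win W T)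

Desir : ∀ {n} → Family n → Fin n → Fin n → Set
Desir W i j = ∀ S → i ∉ S → j ∉ S → Win W (S ∪ ⁅ j ⁆) → Win W (S ∪ ⁅ i ⁆)

EqDesir : ∀ {n} → Family n → Fin n → Fin n → Set
EqDesir W i j = ∀ S → i ∉ S → j ∉ S → (Win W (S ∪ ⁅ i ⁆) → Win W (S ∪ ⁅ j ⁆)) × (Win W (S ∪ ⁅ j ⁆) → Win W (S ∪ ⁅ i ⁆))

IsComplete : ∀ {n} → Family n → Set
IsComplete W = (∀ i → Desir W i i)
             × (∀ i j k → Desir W i j → Desir W j k → Desir W i k)
             × (∀ i j → Desir W i j ⊎ Desir W j i)

-- ≈ has exactly t equivalence classes: there are t pairwise
-- non-equivalent representatives and every player is equivalent to one of them.
HasTypes : ∀ {n} → Family n → ℕ → Set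
HasTypes {n} W t = Σ (Vec (Fin n) t) λ reps →
    (∀ a b → a ≢ b → ¬ EqDesir W (lookup reps a) (lookup reps b))
  × (∀ i → ∃ λ a → EqDesir W i (lookup reps a))

Passer : ∀ {n} → Family n → Fin n → Set
Passer W i = Win W ⁅ i ⁆

SemiVeto : ∀ {n} → Family n → Fin n → Set
SemiVeto W i = Win W (⊤ - i) × (∀ S → Win W S → S ≢ ⊤ - i → i ∈ S)

IsCGPSV : ∀ {n} → Family n → Set
IsCGPSV W = IsSimpleGame W × IsComplete W × (∃ λ i → Passer W i) × (∃ λ j → SemiVeto W j)

IsCGPSVt : ∀ {n} → ℕ → Family n → Set
IsCGPSVt t W = IsCGPSV W × HasTypes W t

image : ∀ {n} → Permutation′ n → Subset n → Subset n
image π S = tabulate (λ j → lookup S (π ⟨$⟩ˡ j))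

Iso : ∀ {n} → Family n → Family n → Set
Iso {n} W W' = ∃ λ (π : Permutation′ n) → ∀ S → W S ≡ W' (image π S)

NumIsoClasses : (n : ℕ) → (Family n → Set) → ℕ → Set
NumIsoClasses n P k = Σ (Vec (Family n) k) λ L →
    All P L
  × (∀ a b → a ≢ b → ¬ Iso (lookup L a) (lookup L b))
  × (∀ W → P W → ∃ λ a → Iso W (lookup L a))

cgpsv : ℕ → ℕ
cgpsv 1 = 0
cgpsv 2 = 2
cgpsv _ = 1

cgpsvt : ℕ → ℕ → ℕ
cgpsvt 2 1 = 1
cgpsvt (suc (suc _)) 2 = 1
cgpsvt _ _ = 0

-- Let p be a passer and v a semi-vetoer. If v is itself a passer, the winning
-- coalitions are exactly those containing v or all of N ∖ {v}; otherwise the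
-- passer {p} must be the only winning coalition without v, so {p} = N ∖ {v},
-- n = 2 and p is a dictator. Both games are determined up to isomorphism by
-- the position of their distinguished player. For n ≥ 3 the first game has two
-- types (v, and everybody else); for n = 2 it is the game in which every
-- nonempty coalition wins, with one type, and the dictator game has two; these
-- two are told apart by whether every player is a passer. For n = 1 a
-- semi-vetoer would make the empty coalition N ∖ {v} winning.
module Submission where

open import Defs
open import Data.Nat using (ℕ; zero; suc; _+_; _≤_)
open import Data.Nat.Properties using (≤-antisym)
open import Data.Bool using (true)
open import Data.Bool.Properties using (⇔→≡) renaming (_≟_ to _≟ᵇ_)
open import Data.Empty using (⊥-elim)
open import Data.Fin using (Fin; zero; suc)
open import Data.Fin.Properties using (_≟_; all?; injective⇒≤)
open import Data.Fin.Subset using (Subset; ⊤; ⊥; ⁅_⁆; _∈_; _∉_; _⊆_; _∪_; _-_; _─_)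
open import Data.Fin.Subset.Properties
  using (∉⊥; ∈⊤; x∈⁅x⁆; x∈⁅y⁆⇒x≡y; x∈p∪q⁺; x∈p∪q⁻; q⊆p∪q; x∈p∧x≢y⇒x∈p-y; ⊆-antisym; _∈?_; ∪-identityˡ)
open import Data.Fin.Permutation using (Permutation′; _⟨$⟩ˡ_; _⟨$⟩ʳ_; inverseˡ; inverseʳ; transpose)
open import Data.Vec using ([]; _∷_; lookup; tabulate)
open import Data.Vec.Base using (here; there)
open import Data.Vec.Properties using (≡-dec; []=⇒lookup; lookup⇒[]=; lookup∘tabulate)
open import Data.Vec.Relation.Unary.All using ([]; _∷_)
open import Data.Product using (_×_; _,_; proj₁; proj₂; ∃; ∃₂)
open import Data.Sum using (_⊎_; inj₁; inj₂) renaming (map to ⊎-map)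
open import Function using (_∘_; case_of_; _⇔_; mk⇔; Equivalence; Injective)
open import Function.Properties.Equivalence using () renaming (trans to ⇔-trans; sym to ⇔-sym)
open import Relation.Binary.PropositionalEquality
open import Relation.Nullary using (¬_; Dec; yes; no; does)
open import Relation.Nullary.Decidable using (_⊎-dec_; _→-dec_; ¬?)

open Equivalence using (to; from)

private
  variable
    n m t : ℕ
    W W' : Family n
    i j k p u v : Fin n
    S : Subset n

_≟ˢ_ : (S T : Subset n) → Dec (S ≡ T)
_≟ˢ_ = ≡-dec _≟ᵇ_

x∈p─q⇒x∉q : ∀ (x : Fin n) (p q : Subset n) → x ∈ p ─ q → x ∉ q
x∈p─q⇒x∉q zero    (_ ∷ p) (true ∷ q) ()        here
x∈p─q⇒x∉q (suc x) (_ ∷ p) (_ ∷ q)    (there h) (there h') = x∈p─q⇒x∉q x p q h h'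

x∈p-y⇒x≢y : i ∈ S - j → i ≢ j
x∈p-y⇒x≢y {i = i} {S = S} h refl = x∈p─q⇒x∉q i S ⁅ i ⁆ h (x∈⁅x⁆ i)

x∈p∪⁅x⁆ : ∀ (S : Subset n) i → i ∈ S ∪ ⁅ i ⁆
x∈p∪⁅x⁆ S i = x∈p∪q⁺ (inj₂ (x∈⁅x⁆ i))

x∈p⇒⁅x⁆⊆p : i ∈ S → ⁅ i ⁆ ⊆ S
x∈p⇒⁅x⁆⊆p {i = i} {S = S} i∈S x∈⁅i⁆ = subst (_∈ S) (sym (x∈⁅y⁆⇒x≡y i x∈⁅i⁆)) i∈S

x∈p∪⁅y⁆-swap : ∀ (S : Subset n) → k ∈ S ∪ ⁅ j ⁆ → k ≢ j → k ∈ S ∪ ⁅ i ⁆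
x∈p∪⁅y⁆-swap {j = j} S k∈ k≢j with x∈p∪q⁻ S ⁅ j ⁆ k∈
... | inj₁ k∈S   = x∈p∪q⁺ (inj₁ k∈S)
... | inj₂ k∈⁅j⁆ = ⊥-elim (k≢j (x∈⁅y⁆⇒x≡y j k∈⁅j⁆))

⁅x⁆≡⊤-y⇒x≢y : ⁅ p ⁆ ≡ ⊤ - v → p ≢ v
⁅x⁆≡⊤-y⇒x≢y {p = p} eq = x∈p-y⇒x≢y (subst (p ∈_) eq (x∈⁅x⁆ p))

⟨$⟩ˡ-injective : ∀ (π : Permutation′ n) → π ⟨$⟩ˡ i ≡ π ⟨$⟩ˡ j → i ≡ j
⟨$⟩ˡ-injective π eq = trans (sym (inverseʳ π)) (trans (cong (π ⟨$⟩ʳ_) eq) (inverseʳ π))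

∈-image⁺ : ∀ (π : Permutation′ n) S → π ⟨$⟩ˡ i ∈ S → i ∈ image π S
∈-image⁺ {i = i} π S h = lookup⇒[]= i _ (trans (lookup∘tabulate _ i) ([]=⇒lookup h))

∈-image⁻ : ∀ (π : Permutation′ n) S → i ∈ image π S → π ⟨$⟩ˡ i ∈ S
∈-image⁻ {i = i} π S h = lookup⇒[]= _ S (trans (sym (lookup∘tabulate _ i)) ([]=⇒lookup h))

AtLeastThree : ℕ → Set
AtLeastThree n = ∀ (a b : Fin n) → ∃ λ c → c ≢ a × c ≢ b

atLeastThree : ∀ {n} → AtLeastThree (suc (suc (suc n)))
atLeastThree zero          zero          = suc zero , (λ ()) , (λ ())
atLeastThree zero          (suc zero)    = suc (suc zero) , (λ ()) , (λ ())
atLeastThree zero          (suc (suc _)) = suc zero , (λ ()) , (λ ())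
atLeastThree (suc zero)    zero          = suc (suc zero) , (λ ()) , (λ ())
atLeastThree (suc zero)    (suc _)       = zero , (λ ()) , (λ ())
atLeastThree (suc (suc _)) zero          = suc zero , (λ ()) , (λ ())
atLeastThree (suc (suc _)) (suc _)       = zero , (λ ()) , (λ ())

⁅x⁆≢⊤-y : {p v : Fin n} → AtLeastThree n → ⁅ p ⁆ ≢ ⊤ - v
⁅x⁆≢⊤-y {p = p} {v} third ⁅p⁆≡ with third p v
... | c , c≢p , c≢v = c≢p (x∈⁅y⁆⇒x≡y p (subst (c ∈_) (sym ⁅p⁆≡) (x∈p∧x≢y⇒x∈p-y ∈⊤ c≢v)))

fin2-≢-unique : {i j v : Fin 2} → i ≢ v → j ≢ v → i ≡ j
fin2-≢-unique {zero}     {zero}     _    _    = refl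
fin2-≢-unique {suc zero} {suc zero} _    _    = refl
fin2-≢-unique {zero}     {suc zero} {zero}     i≢v _ = ⊥-elim (i≢v refl)
fin2-≢-unique {zero}     {suc zero} {suc zero} _ j≢v = ⊥-elim (j≢v refl)
fin2-≢-unique {suc zero} {zero}     {zero}     _ j≢v = ⊥-elim (j≢v refl)
fin2-≢-unique {suc zero} {zero}     {suc zero} i≢v _ = ⊥-elim (i≢v refl)

Monotone : Family n → Set
Monotone W = ∀ S T → Win W S → S ⊆ T → Win W T

Rule : ℕ → Set₁
Rule n = Subset n → Fin n → Set

record Characterised (R : Rule n) (W : Family n) (v : Fin n) : Set where
  constructor characterised
  field
    wins⇔ : ∀ S → Win W S ⇔ R S v

open Characterised

PermutationInvariant : Rule n → Set
PermutationInvariant R = ∀ π S u → R S (π ⟨$⟩ˡ u) ⇔ R (image π S) u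

characterised-iso : {R : Rule n} → PermutationInvariant R →
                    Characterised R W v → Characterised R W' u →
                    (π : Permutation′ n) → π ⟨$⟩ˡ u ≡ v → Iso W W'
characterised-iso {u = u} R-inv cW cW' π refl =
  π , λ S → ⇔→≡ (⇔-trans (wins⇔ cW S) (⇔-trans (R-inv π S u) (⇔-sym (wins⇔ cW' (image π S)))))

HubWins : Rule n
HubWins S v = v ∈ S ⊎ (∀ k → k ≢ v → k ∈ S)

Dictates : Rule n
Dictates S p = p ∈ S

hubWins-invariant : PermutationInvariant {n} HubWins
hubWins-invariant π S u = mk⇔ forth back
  where
  forth : HubWins S (π ⟨$⟩ˡ u) → HubWins (image π S) u
  forth (inj₁ πu∈S) = inj₁ (∈-image⁺ π S πu∈S)
  forth (inj₂ all)  = inj₂ λ k k≢u → ∈-image⁺ π S (all (π ⟨$⟩ˡ k) (k≢u ∘ ⟨$⟩ˡ-injective π))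
  back : HubWins (image π S) u → HubWins S (π ⟨$⟩ˡ u)
  back (inj₁ u∈πS) = inj₁ (∈-image⁻ π S u∈πS)
  back (inj₂ all)  = inj₂ λ k k≢πu → subst (_∈ S) (inverseˡ π)
    (∈-image⁻ π S (all (π ⟨$⟩ʳ k) λ eq → k≢πu (trans (sym (inverseˡ π)) (cong (π ⟨$⟩ˡ_) eq))))

dictates-invariant : PermutationInvariant {n} Dictates
dictates-invariant π S u = mk⇔ (∈-image⁺ π S) (∈-image⁻ π S)

hubWins? : ∀ (S : Subset n) v → Dec (HubWins S v)
hubWins? S v = (v ∈? S) ⊎-dec all? (λ k → ¬? (k ≟ v) →-dec (k ∈? S))

hubGame : Fin n → Family n
hubGame v S = does (hubWins? S v)

does≡true⇔ : ∀ {A : Set} (a? : Dec A) → does a? ≡ true ⇔ A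
does≡true⇔ (yes a)  = mk⇔ (λ _ → a) (λ _ → refl)
does≡true⇔ (no ¬a) = mk⇔ (λ ()) (⊥-elim ∘ ¬a)

hubGame-characterised : Characterised HubWins (hubGame v) v
hubGame-characterised {v = v} = characterised λ S → does≡true⇔ (hubWins? S v)

dictator : Fin n → Family n
dictator p S = lookup S p

dictator-characterised : Characterised Dictates (dictator p) p
dictator-characterised {p = p} = characterised λ S → mk⇔ (lookup⇒[]= p S) []=⇒lookup

-- Desirability

record Dominant (W : Family n) (v : Fin n) : Set where
  constructor dominance
  field
    desir-dominant   : ∀ i j → i ≡ v ⊎ j ≢ v → Desir W i j
    ¬desir-dominated : ∀ i → i ≢ v → ¬ Desir W i v

AllPassers : Family n → Set
AllPassers W = ∀ i → Passer W i

desir-passer : Desir W i j → Passer W j → Passer W i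
desir-passer {W = W} {i} {j} d pass =
  subst (Win W) (∪-identityˡ ⁅ i ⁆) (d ⊥ ∉⊥ ∉⊥ (subst (Win W) (sym (∪-identityˡ ⁅ j ⁆)) pass))

desir-reflexive : i ≡ j → Desir W i j
desir-reflexive refl _ _ _ w = w

dominant⇒complete : Dominant W v → IsComplete W
dominant⇒complete {W = W} {v} (dominance dom strict) =
  (λ i → desir-reflexive {W = W} refl) , transitive , total
  where
  total : ∀ i j → Desir W i j ⊎ Desir W j i
  total i j with i ≟ v | j ≟ v
  ... | yes i≡v | _       = inj₁ (dom i j (inj₁ i≡v))
  ... | no _    | yes j≡v = inj₂ (dom j i (inj₁ j≡v))
  ... | no _    | no j≢v  = inj₁ (dom i j (inj₂ j≢v))
  transitive : ∀ i j k → Desir W i j → Desir W j k → Desir W i k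
  transitive i j k dij djk with i ≟ v | k ≟ v
  ... | yes i≡v | _       = dom i k (inj₁ i≡v)
  ... | no _    | no k≢v  = dom i k (inj₂ k≢v)
  ... | no i≢v  | yes refl with j ≟ v
  ...   | yes refl = ⊥-elim (strict i i≢v dij)
  ...   | no j≢v   = ⊥-elim (strict j j≢v djk)

allPassers⇒desir : Monotone W → AllPassers W → ∀ i j → Desir W i j
allPassers⇒desir mono pass i j S _ _ _ = mono ⁅ i ⁆ _ (pass i) (q⊆p∪q S ⁅ i ⁆)

allDesir⇒complete : (∀ i j → Desir W i j) → IsComplete W
allDesir⇒complete d = (λ i → d i i) , (λ i j k _ _ → d i k) , (λ i j → inj₁ (d i j))

desir-antisym : Desir W i j → Desir W j i → EqDesir W i j
desir-antisym dij dji S i∉S j∉S = dji S j∉S i∉S , dij S i∉S j∉S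

EqDesir⇒Desir : EqDesir W i j → Desir W i j
EqDesir⇒Desir e S i∉S j∉S = proj₂ (e S i∉S j∉S)

EqDesir⇒Desir˘ : EqDesir W i j → Desir W j i
EqDesir⇒Desir˘ e S j∉S i∉S = proj₁ (e S i∉S j∉S)

-- Counting types

module _ {W : Family n} (c : Fin n → Fin m) (c-types : ∀ a b → EqDesir W a b ⇔ c a ≡ c b)
         (s : Fin m → Fin n) (c∘s : ∀ b → c (s b) ≡ b) where

  hasTypes-classified : HasTypes W m
  hasTypes-classified = tabulate s , distinct , cover
    where
    c-reps : ∀ a → c (lookup (tabulate s) a) ≡ a
    c-reps a = trans (cong c (lookup∘tabulate s a)) (c∘s a)
    distinct : ∀ a b → a ≢ b → ¬ EqDesir W (lookup (tabulate s) a) (lookup (tabulate s) b)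
    distinct a b a≢b eq = a≢b (trans (sym (c-reps a)) (trans (to (c-types _ _) eq) (c-reps b)))
    cover : ∀ i → ∃ λ a → EqDesir W i (lookup (tabulate s) a)
    cover i = c i , from (c-types _ _) (sym (c-reps (c i)))

  hasTypes-unique : HasTypes W t → t ≡ m
  hasTypes-unique {t} (reps , distinct , cover) = ≤-antisym (injective⇒≤ type-inj) (injective⇒≤ rep-inj)
    where
    type-inj : Injective _≡_ _≡_ (c ∘ lookup reps)
    type-inj {a} {b} eq with a ≟ b
    ... | yes a≡b = a≡b
    ... | no a≢b  = ⊥-elim (distinct a b a≢b (from (c-types _ _) eq))
    rep : Fin m → Fin t
    rep b = proj₁ (cover (s b))
    c-rep : ∀ b → b ≡ c (lookup reps (rep b))
    c-rep b = trans (sym (c∘s b)) (to (c-types _ _) (proj₂ (cover (s b))))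
    rep-inj : Injective _≡_ _≡_ rep
    rep-inj {b} {b'} eq = trans (c-rep b) (trans (cong (c ∘ lookup reps) eq) (sym (c-rep b')))

  hasTypes⇔ : HasTypes W t ⇔ t ≡ m
  hasTypes⇔ = mk⇔ hasTypes-unique λ { refl → hasTypes-classified }

allEqDesir⇒hasTypes⇔1 : {W : Family n} → (∀ a b → EqDesir W a b) → Fin n → HasTypes W t ⇔ t ≡ 1
allEqDesir⇒hasTypes⇔1 {W = W} eq i =
  hasTypes⇔ {W = W} (λ _ → zero) (λ a b → mk⇔ (λ _ → refl) (λ _ → eq a b))
              (λ _ → i) λ { zero → refl ; (suc ()) }

dominant⇒hasTypes⇔2 : Dominant W v → u ≢ v → HasTypes W t ⇔ t ≡ 2
dominant⇒hasTypes⇔2 {W = W} {v} {u} (dominance dom strict) u≢v =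
  hasTypes⇔ {W = W} side side-types pick pick-side
  where
  side : Fin _ → Fin 2
  side i with i ≟ v
  ... | yes _ = zero
  ... | no _  = suc zero
  side-types : ∀ a b → EqDesir W a b ⇔ side a ≡ side b
  side-types a b with a ≟ v | b ≟ v
  ... | yes a≡v | yes b≡v =
    mk⇔ (λ _ → refl) (λ _ → desir-antisym {W = W} (dom a b (inj₁ a≡v)) (dom b a (inj₁ b≡v)))
  ... | no a≢v  | no b≢v  =
    mk⇔ (λ _ → refl) (λ _ → desir-antisym {W = W} (dom a b (inj₂ b≢v)) (dom b a (inj₂ a≢v)))
  ... | yes refl | no b≢v = mk⇔ (λ e → ⊥-elim (strict b b≢v (EqDesir⇒Desir˘ {W = W} e))) λ ()
  ... | no a≢v | yes refl = mk⇔ (λ e → ⊥-elim (strict a a≢v (EqDesir⇒Desir {W = W} e))) λ ()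
  pick : Fin 2 → Fin _
  pick zero       = v
  pick (suc zero) = u
  pick-side : ∀ b → side (pick b) ≡ b
  pick-side zero with v ≟ v
  ... | yes _   = refl
  ... | no v≢v  = ⊥-elim (v≢v refl)
  pick-side (suc zero) with u ≟ v
  ... | yes u≡v = ⊥-elim (u≢v u≡v)
  ... | no _    = refl

-- Hub games

module _ {W : Family n} {v : Fin n} (cW : Characterised HubWins W v) where

  hub-monotone : Monotone W
  hub-monotone S T w S⊆T with to (wins⇔ cW S) w
  ... | inj₁ v∈S = from (wins⇔ cW T) (inj₁ (S⊆T v∈S))
  ... | inj₂ all = from (wins⇔ cW T) (inj₂ λ k k≢v → S⊆T (all k k≢v))

  hub-simple : ∀ u → u ≢ v → IsSimpleGame W
  hub-simple u u≢v = from (wins⇔ cW ⊤) (inj₁ ∈⊤) , ⊥-loses ∘ to (wins⇔ cW ⊥) , hub-monotone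
    where
    ⊥-loses : ¬ HubWins ⊥ v
    ⊥-loses (inj₁ v∈⊥) = ∉⊥ v∈⊥
    ⊥-loses (inj₂ all) = ∉⊥ (all u u≢v)

  hub-passer : Passer W v
  hub-passer = from (wins⇔ cW ⁅ v ⁆) (inj₁ (x∈⁅x⁆ v))

  hub-semiVeto : SemiVeto W v
  hub-semiVeto = from (wins⇔ cW (⊤ - v)) (inj₂ λ k k≢v → x∈p∧x≢y⇒x∈p-y ∈⊤ k≢v) , vetoes
    where
    vetoes : ∀ S → Win W S → S ≢ ⊤ - v → v ∈ S
    vetoes S w S≢ with to (wins⇔ cW S) w
    ... | inj₁ v∈S = v∈S
    ... | inj₂ all with v ∈? S
    ...   | yes v∈S = v∈S
    ...   | no v∉S  = ⊥-elim (S≢ (⊆-antisym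
              (λ x∈S → x∈p∧x≢y⇒x∈p-y ∈⊤ λ { refl → v∉S x∈S })
              (λ x∈ → all _ (x∈p-y⇒x≢y x∈))))

  hub-dominant : AtLeastThree n → Dominant W v
  hub-dominant third = dominance weak strict
    where
    weak : ∀ i j → i ≡ v ⊎ j ≢ v → Desir W i j
    weak i j (inj₁ refl) S _ _ _ = from (wins⇔ cW (S ∪ ⁅ i ⁆)) (inj₁ (x∈p∪⁅x⁆ S i))
    weak i j (inj₂ j≢v) S i∉S j∉S w with to (wins⇔ cW (S ∪ ⁅ j ⁆)) w
    ... | inj₁ v∈ = from (wins⇔ cW (S ∪ ⁅ i ⁆)) (inj₁ (x∈p∪⁅y⁆-swap S v∈ (j≢v ∘ sym)))
    ... | inj₂ all with i ≟ v
    ...   | yes refl = from (wins⇔ cW (S ∪ ⁅ i ⁆)) (inj₁ (x∈p∪⁅x⁆ S i))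
    ...   | no i≢v with x∈p∪q⁻ S ⁅ j ⁆ (all i i≢v)
    ...     | inj₁ i∈S   = ⊥-elim (i∉S i∈S)
    ...     | inj₂ i∈⁅j⁆ = desir-reflexive {W = W} (x∈⁅y⁆⇒x≡y j i∈⁅j⁆) S i∉S j∉S w
    strict : ∀ i → i ≢ v → ¬ Desir W i v
    strict i i≢v d with to (wins⇔ cW ⁅ i ⁆) (desir-passer {W = W} d hub-passer)
    ... | inj₁ v∈⁅i⁆ = i≢v (sym (x∈⁅y⁆⇒x≡y i v∈⁅i⁆))
    ... | inj₂ all with third v i
    ...   | c , c≢v , c≢i = c≢i (x∈⁅y⁆⇒x≡y i (all c c≢v))

  hub-hasTypes⇔2 : AtLeastThree n → ∀ t → HasTypes W t ⇔ t ≡ 2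
  hub-hasTypes⇔2 third _ = dominant⇒hasTypes⇔2 (hub-dominant third) (proj₂ (proj₂ (third v v)))

hub₂-allPassers : {W : Family 2} → Characterised HubWins W v → AllPassers W
hub₂-allPassers {v = v} cW i with i ≟ v
... | yes refl = from (wins⇔ cW ⁅ i ⁆) (inj₁ (x∈⁅x⁆ i))
... | no i≢v   = from (wins⇔ cW ⁅ i ⁆) (inj₂ λ k k≢v → subst (_∈ ⁅ i ⁆) (fin2-≢-unique i≢v k≢v) (x∈⁅x⁆ i))

hub₂-hasTypes⇔1 : {W : Family 2} → Characterised HubWins W v → ∀ t → HasTypes W t ⇔ t ≡ 1
hub₂-hasTypes⇔1 {v = v} {W = W} cW _ =
  allEqDesir⇒hasTypes⇔1 {W = W} (λ a b → desir-antisym {W = W} (desir a b) (desir b a)) v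
  where
  desir : ∀ i j → Desir W i j
  desir = allPassers⇒desir (hub-monotone cW) (hub₂-allPassers cW)

-- Dictator games

module _ {W : Family n} {p : Fin n} (cW : Characterised Dictates W p) where

  dictator-monotone : Monotone W
  dictator-monotone S T w S⊆T = from (wins⇔ cW T) (S⊆T (to (wins⇔ cW S) w))

  dictator-simple : IsSimpleGame W
  dictator-simple = from (wins⇔ cW ⊤) ∈⊤ , ∉⊥ ∘ to (wins⇔ cW ⊥) , dictator-monotone

  dictator-passer : Passer W p
  dictator-passer = from (wins⇔ cW ⁅ p ⁆) (x∈⁅x⁆ p)

  dictator-dominant : Dominant W p
  dictator-dominant = dominance weak strict
    where
    weak : ∀ i j → i ≡ p ⊎ j ≢ p → Desir W i j
    weak i j (inj₁ refl) S _ _ _  = from (wins⇔ cW (S ∪ ⁅ i ⁆)) (x∈p∪⁅x⁆ S i)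
    weak i j (inj₂ j≢p)  S _ _ w =
      from (wins⇔ cW (S ∪ ⁅ i ⁆)) (x∈p∪⁅y⁆-swap S (to (wins⇔ cW _) w) (j≢p ∘ sym))
    strict : ∀ i → i ≢ p → ¬ Desir W i p
    strict i i≢p d = i≢p (sym (x∈⁅y⁆⇒x≡y i (to (wins⇔ cW ⁅ i ⁆) (desir-passer {W = W} d dictator-passer))))

  dictator-semiVeto : ⁅ p ⁆ ≡ ⊤ - v → SemiVeto W v
  dictator-semiVeto {v} ⁅p⁆≡ = from (wins⇔ cW (⊤ - v)) (subst (p ∈_) ⁅p⁆≡ (x∈⁅x⁆ p)) , vetoes
    where
    vetoes : ∀ S → Win W S → S ≢ ⊤ - v → v ∈ S
    vetoes S w S≢ with v ∈? S
    ... | yes v∈S = v∈S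
    ... | no v∉S  = ⊥-elim (S≢ (trans (⊆-antisym S⊆⁅p⁆ (x∈p⇒⁅x⁆⊆p (to (wins⇔ cW S) w))) ⁅p⁆≡))
      where
      S⊆⁅p⁆ : S ⊆ ⁅ p ⁆
      S⊆⁅p⁆ x∈S = subst (_ ∈_) (sym ⁅p⁆≡) (x∈p∧x≢y⇒x∈p-y ∈⊤ λ { refl → v∉S x∈S })

  dictator-hasTypes⇔2 : ⁅ p ⁆ ≡ ⊤ - v → ∀ t → HasTypes W t ⇔ t ≡ 2
  dictator-hasTypes⇔2 ⁅p⁆≡ _ = dominant⇒hasTypes⇔2 dictator-dominant (⁅x⁆≡⊤-y⇒x≢y ⁅p⁆≡ ∘ sym)

  dictator-¬allPassers : ∀ u → u ≢ p → ¬ AllPassers W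
  dictator-¬allPassers u u≢p pass = u≢p (sym (x∈⁅y⁆⇒x≡y u (to (wins⇔ cW ⁅ u ⁆) (pass u))))

-- Classification

passer-semiVetoer⇒hub : Monotone W → Passer W v → SemiVeto W v → Characterised HubWins W v
passer-semiVetoer⇒hub {W = W} {v} mono v-passes (wins-all-but , vetoes) =
  characterised λ S → mk⇔ (forth S) back
  where
  forth : ∀ S → Win W S → HubWins S v
  forth S w with S ≟ˢ (⊤ - v)
  ... | yes refl = inj₂ λ k k≢v → x∈p∧x≢y⇒x∈p-y ∈⊤ k≢v
  ... | no S≢    = inj₁ (vetoes S w S≢)
  back : HubWins S v → Win W S
  back {S} (inj₁ v∈S) = mono ⁅ v ⁆ S v-passes (x∈p⇒⁅x⁆⊆p v∈S)
  back {S} (inj₂ all) = mono (⊤ - v) S wins-all-but λ x∈ → all _ (x∈p-y⇒x≢y x∈)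

semiVetoer-¬passer⇒dictator : Monotone W → Passer W p → SemiVeto W v → ¬ Passer W v →
                               ⁅ p ⁆ ≡ ⊤ - v × Characterised Dictates W p
semiVetoer-¬passer⇒dictator {W = W} {p} {v} mono p-passes (_ , vetoes) v-loses =
  ⁅p⁆≡ , characterised λ S → mk⇔ (forth S) (λ p∈S → mono ⁅ p ⁆ _ p-passes (x∈p⇒⁅x⁆⊆p p∈S))
  where
  ⁅p⁆≡ : ⁅ p ⁆ ≡ ⊤ - v
  ⁅p⁆≡ with ⁅ p ⁆ ≟ˢ (⊤ - v)
  ... | yes eq = eq
  ... | no ne  = ⊥-elim (v-loses (subst (Passer W) (sym (x∈⁅y⁆⇒x≡y p (vetoes ⁅ p ⁆ p-passes ne))) p-passes))
  -- A winning S ∌ p is not ⊤ - v = ⁅ p ⁆, so it contains v and nobody else: S ⊆ ⁅ v ⁆.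
  forth : ∀ S → Win W S → p ∈ S
  forth S w with p ∈? S
  ... | yes p∈S = p∈S
  ... | no p∉S  = ⊥-elim (v-loses (mono S ⁅ v ⁆ w S⊆⁅v⁆))
    where
    S⊆⁅v⁆ : S ⊆ ⁅ v ⁆
    S⊆⁅v⁆ {x} x∈S with x ≟ v
    ... | yes refl = x∈⁅x⁆ x
    ... | no x≢v   = ⊥-elim (p∉S (subst (_∈ S)
            (x∈⁅y⁆⇒x≡y p (subst (x ∈_) (sym ⁅p⁆≡) (x∈p∧x≢y⇒x∈p-y ∈⊤ x≢v))) x∈S))

cgpsv-classification : IsCGPSV W →
  (∃ λ v → Characterised HubWins W v) ⊎ (∃₂ λ p v → ⁅ p ⁆ ≡ ⊤ - v × Characterised Dictates W p)
cgpsv-classification {W = W} ((_ , _ , mono) , _ , (p , p-passes) , (v , semiVeto))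
  with W ⁅ v ⁆ ≟ᵇ true
... | yes v-passes = inj₁ (v , passer-semiVetoer⇒hub mono v-passes semiVeto)
... | no v-loses   = inj₂ (p , v , semiVetoer-¬passer⇒dictator mono p-passes semiVeto v-loses)

iso-preserves-allPassers : Monotone W' → Iso W W' → AllPassers W → AllPassers W'
iso-preserves-allPassers mono (π , same) pass j =
  mono _ ⁅ j ⁆ (trans (sym (same ⁅ π ⟨$⟩ˡ j ⁆)) (pass (π ⟨$⟩ˡ j))) image⊆⁅j⁆
  where
  image⊆⁅j⁆ : image π ⁅ π ⟨$⟩ˡ j ⁆ ⊆ ⁅ j ⁆
  image⊆⁅j⁆ x∈ = subst (_∈ ⁅ j ⁆) (sym (⟨$⟩ˡ-injective π (x∈⁅y⁆⇒x≡y _ (∈-image⁻ π _ x∈)))) (x∈⁅x⁆ j)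

iso-reflects-allPassers : Monotone W' → Iso W W' → AllPassers W' → AllPassers W
iso-reflects-allPassers mono (π , same) pass i =
  trans (same ⁅ i ⁆) (mono ⁅ π ⟨$⟩ʳ i ⁆ _ (pass (π ⟨$⟩ʳ i)) ⁅πi⁆⊆image)
  where
  ⁅πi⁆⊆image : ⁅ π ⟨$⟩ʳ i ⁆ ⊆ image π ⁅ i ⁆
  ⁅πi⁆⊆image x∈ with x∈⁅y⁆⇒x≡y _ x∈
  ... | refl = ∈-image⁺ π ⁅ i ⁆ (subst (_∈ ⁅ i ⁆) (sym (inverseˡ π)) (x∈⁅x⁆ i))

-- Counting isomorphism classes

module _ {P : Family n → Set} where

  numIsoClasses-none : (∀ W → ¬ P W) → NumIsoClasses n P 0
  numIsoClasses-none none = [] , [] , (λ ()) , λ W w → ⊥-elim (none W w)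

  numIsoClasses-one : {W₀ : Family n} → P W₀ → (∀ W → P W → Iso W W₀) → NumIsoClasses n P 1
  numIsoClasses-one {W₀} w₀ iso = (W₀ ∷ []) , (w₀ ∷ []) , distinct , λ W w → zero , iso W w
    where
    distinct : ∀ a b → a ≢ b → ¬ Iso (lookup (W₀ ∷ []) a) (lookup (W₀ ∷ []) b)
    distinct zero zero a≢b = ⊥-elim (a≢b refl)

  numIsoClasses-two : {W₀ W₁ : Family n} → P W₀ → P W₁ → ¬ Iso W₀ W₁ → ¬ Iso W₁ W₀ →
                      (∀ W → P W → Iso W W₀ ⊎ Iso W W₁) → NumIsoClasses n P 2
  numIsoClasses-two {W₀} {W₁} w₀ w₁ W₀≇W₁ W₁≇W₀ iso = (W₀ ∷ W₁ ∷ []) , (w₀ ∷ w₁ ∷ []) , distinct , cover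
    where
    distinct : ∀ a b → a ≢ b → ¬ Iso (lookup (W₀ ∷ W₁ ∷ []) a) (lookup (W₀ ∷ W₁ ∷ []) b)
    distinct zero       zero       a≢b = ⊥-elim (a≢b refl)
    distinct zero       (suc zero) _   = W₀≇W₁
    distinct (suc zero) zero       _   = W₁≇W₀
    distinct (suc zero) (suc zero) a≢b = ⊥-elim (a≢b refl)
    cover : ∀ W → P W → ∃ λ a → Iso W (lookup (W₀ ∷ W₁ ∷ []) a)
    cover W w with iso W w
    ... | inj₁ W≅W₀ = zero , W≅W₀
    ... | inj₂ W≅W₁ = suc zero , W≅W₁

cgpsv₁-empty : (W : Family 1) → ¬ IsCGPSV W
cgpsv₁-empty W ((_ , ⊥-loses , _) , _ , _ , (zero , wins-all-but , _)) = ⊥-loses wins-all-but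

module ThreeOrMore {k : ℕ} where

  hub : Family (3 + k)
  hub = hubGame zero

  hub-characterised : Characterised HubWins hub zero
  hub-characterised = hubGame-characterised

  cgpsv-hub : {W : Family (3 + k)} → IsCGPSV W → ∃ λ v → Characterised HubWins W v
  cgpsv-hub P with cgpsv-classification P
  ... | inj₁ characterisation = characterisation
  ... | inj₂ (_ , _ , ⁅p⁆≡ , _) = ⊥-elim (⁅x⁆≢⊤-y atLeastThree ⁅p⁆≡)

  cgpsv≅hub : {W : Family (3 + k)} → IsCGPSV W → Iso W hub
  cgpsv≅hub P with cgpsv-hub P
  ... | v , cW = characterised-iso hubWins-invariant cW hub-characterised (transpose v zero) refl

  cgpsv-types : {W : Family (3 + k)} → IsCGPSV W → HasTypes W t → t ≡ 2
  cgpsv-types P = to (hub-hasTypes⇔2 (proj₂ (cgpsv-hub P)) atLeastThree _)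

  hub-cgpsv : IsCGPSV hub
  hub-cgpsv = hub-simple hub-characterised (suc zero) (λ ())
            , dominant⇒complete (hub-dominant hub-characterised atLeastThree)
            , (zero , hub-passer hub-characterised) , (zero , hub-semiVeto hub-characterised)

  count : NumIsoClasses (3 + k) IsCGPSV 1
  count = numIsoClasses-one hub-cgpsv (λ _ → cgpsv≅hub)

  count-types : ∀ t → NumIsoClasses (3 + k) (IsCGPSVt t) (cgpsvt (3 + k) t)
  count-types 0 = numIsoClasses-none λ { _ (P , T) → case (cgpsv-types P T) of λ () }
  count-types 1 = numIsoClasses-none λ { _ (P , T) → case (cgpsv-types P T) of λ () }
  count-types 2 = numIsoClasses-one (hub-cgpsv , from (hub-hasTypes⇔2 hub-characterised atLeastThree 2) refl)
                    (λ _ → cgpsv≅hub ∘ proj₁)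
  count-types (suc (suc (suc t))) = numIsoClasses-none λ { _ (P , T) → case (cgpsv-types P T) of λ () }

module TwoPlayers where

  hub dict : Family 2
  hub  = hubGame zero
  dict = dictator zero

  hub-characterised : Characterised HubWins hub zero
  hub-characterised = hubGame-characterised

  dict-characterised : Characterised Dictates dict zero
  dict-characterised = dictator-characterised

  cgpsv-cases : {W : Family 2} → IsCGPSV W →
    (Iso W hub × (∀ t → HasTypes W t ⇔ t ≡ 1)) ⊎ (Iso W dict × (∀ t → HasTypes W t ⇔ t ≡ 2))
  cgpsv-cases P with cgpsv-classification P
  ... | inj₁ (v , cW) =
    inj₁ (characterised-iso hubWins-invariant cW hub-characterised (transpose v zero) refl
         , hub₂-hasTypes⇔1 cW)
  ... | inj₂ (p , v , ⁅p⁆≡ , cW) =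
    inj₂ (characterised-iso dictates-invariant cW dict-characterised (transpose p zero) refl
         , dictator-hasTypes⇔2 cW ⁅p⁆≡)

  hub-cgpsv : IsCGPSV hub
  hub-cgpsv = hub-simple hub-characterised (suc zero) (λ ())
            , allDesir⇒complete {W = hub} (allPassers⇒desir (hub-monotone hub-characterised)
                                                             (hub₂-allPassers hub-characterised))
            , (zero , hub-passer hub-characterised) , (zero , hub-semiVeto hub-characterised)

  dict-cgpsv : IsCGPSV dict
  dict-cgpsv = dictator-simple dict-characterised
             , dominant⇒complete (dictator-dominant dict-characterised)
             , (zero , dictator-passer dict-characterised)
             , (suc zero , dictator-semiVeto dict-characterised refl)

  hub≇dict : ¬ Iso hub dict
  hub≇dict iso = dictator-¬allPassers dict-characterised (suc zero) (λ ())
    (iso-preserves-allPassers (dictator-monotone dict-characterised) iso (hub₂-allPassers hub-characterised))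

  dict≇hub : ¬ Iso dict hub
  dict≇hub iso = dictator-¬allPassers dict-characterised (suc zero) (λ ())
    (iso-reflects-allPassers (hub-monotone hub-characterised) iso (hub₂-allPassers hub-characterised))

  count : NumIsoClasses 2 IsCGPSV 2
  count = numIsoClasses-two hub-cgpsv dict-cgpsv hub≇dict dict≇hub λ _ → ⊎-map proj₁ proj₁ ∘ cgpsv-cases

  cgpsv-types : {W : Family 2} → IsCGPSV W → HasTypes W t → t ≡ 1 ⊎ t ≡ 2
  cgpsv-types P T with cgpsv-cases P
  ... | inj₁ (_ , types) = inj₁ (to (types _) T)
  ... | inj₂ (_ , types) = inj₂ (to (types _) T)

  count-types : ∀ t → NumIsoClasses 2 (IsCGPSVt t) (cgpsvt 2 t)
  count-types 0 = numIsoClasses-none λ { _ (P , T) → case (cgpsv-types P T) of λ { (inj₁ ()) ; (inj₂ ()) } }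
  count-types 1 = numIsoClasses-one (hub-cgpsv , from (hub₂-hasTypes⇔1 hub-characterised 1) refl) cover
    where
    cover : ∀ W → IsCGPSVt 1 W → Iso W hub
    cover _ (P , T) with cgpsv-cases P
    ... | inj₁ (W≅hub , _) = W≅hub
    ... | inj₂ (_ , types) = case to (types 1) T of λ ()
  count-types 2 =
    numIsoClasses-one (dict-cgpsv , from (dictator-hasTypes⇔2 dict-characterised {v = suc zero} refl 2) refl) cover
    where
    cover : ∀ W → IsCGPSVt 2 W → Iso W dict
    cover _ (P , T) with cgpsv-cases P
    ... | inj₁ (_ , types) = case to (types 2) T of λ ()
    ... | inj₂ (W≅dict , _) = W≅dict
  count-types (suc (suc (suc t))) =
    numIsoClasses-none λ { _ (P , T) → case (cgpsv-types P T) of λ { (inj₁ ()) ; (inj₂ ()) } }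

lemmaL : ((n : ℕ) → 1 ≤ n → NumIsoClasses n IsCGPSV (cgpsv n))
       × ((n t : ℕ) → 1 ≤ n → NumIsoClasses n (IsCGPSVt t) (cgpsvt n t))
lemmaL = count , count-types
  where
  count : (n : ℕ) → 1 ≤ n → NumIsoClasses n IsCGPSV (cgpsv n)
  count 1                   _ = numIsoClasses-none cgpsv₁-empty
  count 2                   _ = TwoPlayers.count
  count (suc (suc (suc k))) _ = ThreeOrMore.count
  count-types : (n t : ℕ) → 1 ≤ n → NumIsoClasses n (IsCGPSVt t) (cgpsvt n t)
  count-types 1                   _ _ = numIsoClasses-none λ W → cgpsv₁-empty W ∘ proj₁
  count-types 2                   t _ = TwoPlayers.count-types t
  count-types (suc (suc (suc k))) t _ = ThreeOrMore.count-types t
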